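{- Let $\ell \geq 2$ and let $G$ be a $K_{\ell}$-critical graph with chromatic number $k$ such that $G$ is not isomorphic to $K_k$. Then every vertex of $G$ which lies on a copy of $K_{\ell}$ has degree at least $k + 2\ell - 3$. Moreover, for every $1 \leq i \leq \ell$, if $H$ is a copy of $K_i$ contained in some copy of $K_{\ell}$ in $G$, then $d(H) \geq k - \ell + 3(\ell - i)$.
   Context: All graphs are finite and simple. For a subgraph $H$, $N(H) = \bigcap_{v \in V(H)} N(v)$ is the common neighborhood of $H$ and $d(H) = |N(H)|$. For $\ell \geq 2$, a graph $G$ is called $K_{\ell}$-critical if (i) $G$ contains $K_{\ell}$ as a subgraph; (ii) $G$ is critical, i.e. removing any vertex reduces the chromatic number of $G$ by one; (iii) removing the vertex set of any copy of $K_{\ell}$ in $G$ reduces the chromatic number of $G$ by exactly $\ell$. -}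

module Defs where

open import Data.Nat using (ℕ; _≤_; _∸_)
open import Data.Fin using (Fin)
open import Data.Bool using (Bool; true; false)
open import Data.List using (List; length; filterᵇ; map)
open import Data.Bool.ListAction using (and)
open import Data.List.Base using (allFin)
open import Data.Product using (Σ; ∃; _×_; ∃-syntax)
open import Relation.Binary.PropositionalEquality using (_≡_; _≢_)
open import Function.Definitions using (Injective)
open import Function.Bundles using (_↔_; Inverse)

record Graph (n : ℕ) : Set where
  field
    adj   : Fin n → Fin n → Bool
    adj-sym : ∀ u v → adj u v ≡ adj v u
    adj-irrefl : ∀ v → adj v v ≡ false
open Graph public

open import Data.Fin using (_≟_)
open import Relation.Nullary.Decidable using (does)
open import Data.Bool using (not)

complete : (k : ℕ) → Graph k
complete k = record
  { adj = λ u v → not (does (u ≟ v))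
  ; adj-sym = symP
  ; adj-irrefl = irr }
  where
    open import Relation.Binary.PropositionalEquality using (refl; sym)
    open import Relation.Nullary using (yes; no)
    symP : ∀ (u v : Fin k) → not (does (u ≟ v)) ≡ not (does (v ≟ u))
    symP u v with u ≟ v | v ≟ u
    ... | yes _ | yes _ = refl
    ... | no _  | no _  = refl
    ... | yes p | no q  = Data.Empty.⊥-elim (q (sym p))
      where import Data.Empty
    ... | no q  | yes p = Data.Empty.⊥-elim (q (sym p))
      where import Data.Empty
    irr : ∀ (v : Fin k) → not (does (v ≟ v)) ≡ false
    irr v with v ≟ v
    ... | yes _ = refl
    ... | no q  = Data.Empty.⊥-elim (q refl)
      where import Data.Empty

Iso : ∀ {n m} → Graph n → Graph m → Set
Iso {n} {m} G H =
  Σ (Fin n ↔ Fin m) λ f →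
    ∀ u v → adj G u v ≡ adj H (Inverse.to f u) (Inverse.to f v)

ColourableOn : ∀ {n} → Graph n → (Fin n → Set) → ℕ → Set
ColourableOn {n} G P m =
  Σ (Fin n → Fin m) λ c →
    ∀ u v → P u → P v → adj G u v ≡ true → c u ≢ c v

ChromaticOn : ∀ {n} → Graph n → (Fin n → Set) → ℕ → Set
ChromaticOn G P k = ColourableOn G P k × (∀ m → ColourableOn G P m → k ≤ m)

Chromatic : ∀ {n} → Graph n → ℕ → Set
Chromatic G k = ChromaticOn G (λ _ → Data.Unit.⊤) k
  where import Data.Unit

IsClique : ∀ {n} → Graph n → (ℓ : ℕ) → (Fin ℓ → Fin n) → Set
IsClique G ℓ f = Injective _≡_ _≡_ f × (∀ a b → a ≢ b → adj G (f a) (f b) ≡ true)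

-- Vertex u is not in the image of f (i.e. survives removal of V(f)).
Outside : ∀ {n ℓ} → (Fin ℓ → Fin n) → Fin n → Set
Outside f u = ∀ a → f a ≢ u

KCritical : ∀ {n} → Graph n → (ℓ k : ℕ) → Set
KCritical {n} G ℓ k =
    Chromatic G k
  × (∃[ f ] IsClique G ℓ f)
  × (∀ (v : Fin n) → ChromaticOn G (λ u → u ≢ v) (k ∸ 1))
  × (∀ (f : Fin ℓ → Fin n) → IsClique G ℓ f → ChromaticOn G (Outside f) (k ∸ ℓ))

degree : ∀ {n} → Graph n → Fin n → ℕ
degree {n} G u = length (filterᵇ (λ v → adj G u v) (allFin n))

-- d(H) = |N(H)|, the size of the common neighbourhood of the vertices g(0..i-1).
commonDeg : ∀ {n i} → Graph n → (Fin i → Fin n) → ℕ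
commonDeg {n} {i} G g =
  length (filterᵇ (λ v → and (map (λ j → adj G (g j) v) (allFin i))) (allFin n))

{-# OPTIONS --safe #-}
-- Fix a copy f of K_ℓ and a proper (k − ℓ)-colouring c of G − f, which exists by criticality.
-- Every colour class of c contains a common neighbour of f: otherwise keep c, give f(0) that
-- colour and the other ℓ − 1 vertices of f fresh colours, and move each vertex of the class to
-- the colour of a vertex of f it misses; this (k − 1)-colours G. Hence d(f) ≥ k − ℓ, and N(f)
-- is not a clique, for together with f it would be a K_k, and a vertex-critical graph of
-- chromatic number k containing K_k is K_k.
-- Now let H = K_i lie in f with i < ℓ, so H misses some f(a), and take non-adjacent u, z ∈ N(f).
-- Exchanging f(a) for z gives another K_ℓ, whose removal colouring has a common neighbour w of
-- the new clique in the colour class of u. Then u, z, w ∈ N(H) ∖ N(H + u), while H + u lies in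
-- the K_ℓ obtained by exchanging f(a) for u; induction on ℓ − i gives
-- d(H) ≥ k − ℓ + 3(ℓ − i), and i = 1 is the degree bound.
module Submission where

open import Data.Bool using (Bool; true; false; T; T?; not; _∧_)
open import Data.Bool.ListAction using (and)
open import Data.Bool.Properties using (T-≡; ¬-not; ∧-identityʳ) renaming (_≟_ to _≟ᵇ_)
open import Data.Empty using (⊥-elim)
open import Data.Fin using (Fin; zero; suc; _≟_; splitAt; join)
open import Data.Fin.Properties
  using (any?; all?; injective⇒≤; ¬∀⟶∃¬; splitAt-join; join-splitAt; nonZeroIndex)
open import Data.List as List using (List; length; filterᵇ; allFin; lookup; map)
open import Data.List.Membership.Propositional using (_∈_)
open import Data.List.Membership.Propositional.Properties using (∈-filter⁺; ∈-allFin)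
open import Data.List.Properties using (filter-≐)
open import Data.List.Relation.Unary.Any using (index)
open import Data.List.Relation.Unary.Any.Properties using (lookup-index)
open import Data.List.Relation.Unary.All.Properties using (all⁺; all⁻; tabulate⁺; tabulate⁻)
open import Data.Nat using (ℕ; zero; suc; _+_; _*_; _∸_; _≤_; _<_; s≤s; z<s)
open import Data.Nat.Properties
  using (+-suc; +-comm; +-assoc; +-identityʳ; *-suc; +-monoʳ-≤; +-monoˡ-≤; ≤-trans; ≤-reflexive;
         ≤-antisym; <-irrefl; <-≤-trans; <⇒≱; m<m+n; m≤pred[n]⇒suc[m]≤n; m∸n+n≡m; m≤n+m∸n;
         m+n∸m≡n; m+[n∸m]≡n; module ≤-Reasoning)
open import Data.Nat.Tactic.RingSolver using (solve-∀)
open import Data.Product using (∃; ∃₂; ∃-syntax; _×_; _,_; proj₁; proj₂; curry)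
open import Data.Sum using (_⊎_; inj₁; inj₂; [_,_]′)
open import Data.Sum.Properties using (inj₁-injective)
open import Data.Unit using (⊤; tt)
open import Data.Vec.Functional using ([]; _∷_; _++_; updateAt)
open import Data.Vec.Functional.Properties using (updateAt-updates; updateAt-minimal)
open import Function using (_∘_; id; const; case_of_; Equivalence)
open import Function.Definitions using (Injective)
open import Function.Properties.Inverse using (↔-refl)
open import Relation.Binary.PropositionalEquality
open import Relation.Nullary using (¬_; yes; no; contradiction)
open import Relation.Nullary.Decidable using (¬?; _×-dec_)
open import Relation.Unary using (Decidable)

open import Defs

count : {A : Set} → (A → Bool) → List A → ℕ
count p xs = length (filterᵇ p xs)

module _ {A : Set} where

  count-cong : {p q : A → Bool} → (∀ x → p x ≡ q x) → ∀ xs → count p xs ≡ count q xs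
  count-cong {p} {q} p≗q xs =
    cong length (filter-≐ (T? ∘ p) (T? ∘ q) p≐q xs)
    where
    p≐q = (λ {x} → subst T (p≗q x)) , (λ {x} → subst T (sym (p≗q x)))

  count-split : {p q : A → Bool} → (∀ {x} → T (q x) → T (p x)) → ∀ xs →
                count q xs + count (λ x → p x ∧ not (q x)) xs ≡ count p xs
  count-split q⊆p List.[] = refl
  count-split {p} {q} q⊆p (x List.∷ xs) with p x in px | q x in qx
  ... | true  | true  = cong suc (count-split q⊆p xs)
  ... | true  | false = trans (+-suc _ _) (cong suc (count-split q⊆p xs))
  ... | false | false = count-split q⊆p xs
  ... | false | true  = case subst T px (q⊆p (subst T (sym qx) tt)) of λ ()

  injective⇒≤length : ∀ {m} {xs : List A} {h : Fin m → A} →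
                      Injective _≡_ _≡_ h → (∀ a → h a ∈ xs) → m ≤ length xs
  injective⇒≤length {xs = xs} {h} h-inj h∈xs = injective⇒≤ (λ {a} {b} e → h-inj (begin
    h a                          ≡⟨ lookup-index (h∈xs a) ⟩
    lookup xs (index (h∈xs a))   ≡⟨ cong (lookup xs) e ⟩
    lookup xs (index (h∈xs b))   ≡⟨ lookup-index (h∈xs b) ⟨
    h b                          ∎))
    where open ≡-Reasoning

  ≤-count : ∀ {m} {p : A → Bool} {xs : List A} {h : Fin m → A} →
            Injective _≡_ _≡_ h → (∀ a → h a ∈ xs) → (∀ a → T (p (h a))) → m ≤ count p xs
  ≤-count {p = p} h-inj h∈xs ph = injective⇒≤length h-inj (λ a → ∈-filter⁺ (T? ∘ p) (h∈xs a) (ph a))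

  T-∧-not : ∀ {x y} → T x → ¬ T y → T (x ∧ not y)
  T-∧-not {true} {false} _ _ = tt
  T-∧-not {true} {true}  _ ¬y = contradiction tt ¬y

  count-+-≤ : ∀ {m} {p q : A → Bool} {xs : List A} {h : Fin m → A} → (∀ {x} → T (q x) → T (p x)) →
              Injective _≡_ _≡_ h → (∀ a → h a ∈ xs) → (∀ a → T (p (h a))) → (∀ a → ¬ T (q (h a))) →
              count q xs + m ≤ count p xs
  count-+-≤ {m} {p} {q} {xs} q⊆p h-inj h∈xs ph ¬qh = begin
    count q xs + m                                  ≤⟨ +-monoʳ-≤ (count q xs) p∖q-bound ⟩
    count q xs + count (λ x → p x ∧ not (q x)) xs  ≡⟨ count-split q⊆p xs ⟩
    count p xs                                      ∎
    where
    open ≤-Reasoning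
    p∖q-bound : m ≤ count (λ x → p x ∧ not (q x)) xs
    p∖q-bound = ≤-count h-inj h∈xs (λ a → T-∧-not (ph a) (¬qh a))

∷-injective : ∀ {A : Set} {i} {x : A} {g : Fin i → A} → (∀ j → g j ≢ x) → Injective _≡_ _≡_ g →
              Injective _≡_ _≡_ (x ∷ g)
∷-injective x∉g g-inj {zero}  {zero}  _ = refl
∷-injective x∉g g-inj {zero}  {suc j} e = contradiction (sym e) (x∉g j)
∷-injective x∉g g-inj {suc i} {zero}  e = contradiction e (x∉g i)
∷-injective x∉g g-inj {suc i} {suc j} e = cong suc (g-inj e)

splitAt-injective : ∀ m {n} → Injective _≡_ _≡_ (splitAt m {n})
splitAt-injective m {n} {x} {y} e =
  trans (sym (join-splitAt m n x)) (trans (cong (join m n) e) (join-splitAt m n y))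

join-injective : ∀ m {n} → Injective _≡_ _≡_ (join m n)
join-injective m {n} {x} {y} e =
  trans (sym (splitAt-join m n x)) (trans (cong (splitAt m) e) (splitAt-join m n y))

_⊆_ : ∀ {n i ℓ} → (Fin i → Fin n) → (Fin ℓ → Fin n) → Set
g ⊆ f = ∀ j → ∃ λ a → g j ≡ f a

missed-vertex : ∀ {n i ℓ} {g : Fin i → Fin n} {f : Fin ℓ → Fin n} → i < ℓ → Injective _≡_ _≡_ f →
                ∃ λ a → ∀ j → g j ≢ f a
missed-vertex {n} {i} {ℓ} {g} {f} i<ℓ f-inj with all? (λ a → any? (λ j → g j ≟ f a))
... | yes f⊆g = contradiction (injective⇒≤ preimage-inj) (<⇒≱ i<ℓ)
  where
  preimage-inj : Injective _≡_ _≡_ (proj₁ ∘ f⊆g)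
  preimage-inj {a} {b} e = f-inj (trans (sym (proj₂ (f⊆g a))) (trans (cong g e) (proj₂ (f⊆g b))))
... | no f⊈g = let a , ¬hit = ¬∀⟶∃¬ ℓ _ (λ a → any? (λ j → g j ≟ f a)) f⊈g in a , curry ¬hit

⊆-avoiding : ∀ {n i ℓ} {g : Fin i → Fin n} {f : Fin ℓ → Fin n} {a} → g ⊆ f → (∀ j → g j ≢ f a) →
             ∀ j → ∃ λ b → b ≢ a × g j ≡ f b
⊆-avoiding g⊆f a∉g j = let b , gj≡fb = g⊆f j in b , (λ { refl → a∉g j gj≡fb }) , gj≡fb

∷-⊆-updateAt : ∀ {n i ℓ} {g : Fin i → Fin n} {f : Fin ℓ → Fin n} {a u} → g ⊆ f → (∀ j → g j ≢ f a) →
               (u ∷ g) ⊆ updateAt f a (const u)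
∷-⊆-updateAt {f = f} {a} {u} g⊆f a∉g zero    = a , sym (updateAt-updates a {const u} f)
∷-⊆-updateAt {f = f} {a} {u} g⊆f a∉g (suc j) =
  let b , b≢a , gj≡fb = ⊆-avoiding g⊆f a∉g j in b , trans gj≡fb (sym (updateAt-minimal b a f b≢a))

module _ {n} (G : Graph n) where

  adj⇒≢ : ∀ {u v} → adj G u v ≡ true → u ≢ v
  adj⇒≢ {u} uv refl = case trans (sym uv) (adj-irrefl G u) of λ ()

  CommonNeighbour : ∀ {i} → (Fin i → Fin n) → Fin n → Set
  CommonNeighbour g v = ∀ j → adj G (g j) v ≡ true

  commonNeighbour? : ∀ {i} (g : Fin i → Fin n) → Decidable (CommonNeighbour g)
  commonNeighbour? g v = all? (λ j → adj G (g j) v ≟ᵇ true)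

  isCommonNeighbour : ∀ {i} → (Fin i → Fin n) → Fin n → Bool
  isCommonNeighbour {i} g v = and (map (λ j → adj G (g j) v) (allFin i))

  isCommonNeighbour⁺ : ∀ {i} {g : Fin i → Fin n} {v} → CommonNeighbour g v → T (isCommonNeighbour g v)
  isCommonNeighbour⁺ {g = g} {v} v∈N =
    all⁻ (λ j → adj G (g j) v) (tabulate⁺ (λ j → Equivalence.from T-≡ (v∈N j)))

  isCommonNeighbour⁻ : ∀ {i} {g : Fin i → Fin n} {v} → T (isCommonNeighbour g v) → CommonNeighbour g v
  isCommonNeighbour⁻ {i} {g} {v} t j =
    Equivalence.to T-≡ (tabulate⁻ (all⁺ (λ j → adj G (g j) v) (allFin i) t) j)

  commonDeg-≥ : ∀ {i m} {g : Fin i → Fin n} {h : Fin m → Fin n} → Injective _≡_ _≡_ h →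
                (∀ a → CommonNeighbour g (h a)) → m ≤ commonDeg G g
  commonDeg-≥ h-inj h∈N = ≤-count h-inj (∈-allFin ∘ _) (isCommonNeighbour⁺ ∘ h∈N)

  commonDeg-∷ : ∀ {i m u} {g : Fin i → Fin n} {h : Fin m → Fin n} → Injective _≡_ _≡_ h →
                (∀ a → CommonNeighbour g (h a)) → (∀ a → adj G u (h a) ≡ false) →
                commonDeg G (u ∷ g) + m ≤ commonDeg G g
  commonDeg-∷ {u = u} {g} h-inj h∈N u≁h =
    count-+-≤ narrower h-inj (∈-allFin ∘ _) (isCommonNeighbour⁺ ∘ h∈N)
      (λ a t → case trans (sym (u≁h a)) (isCommonNeighbour⁻ {g = u ∷ g} t zero) of λ ())
    where
    narrower : ∀ {v} → T (isCommonNeighbour (u ∷ g) v) → T (isCommonNeighbour g v)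
    narrower t = isCommonNeighbour⁺ (isCommonNeighbour⁻ {g = u ∷ g} t ∘ suc)

  degree≡commonDeg : ∀ v → degree G v ≡ commonDeg G (v ∷ [])
  degree≡commonDeg v = count-cong (λ u → sym (∧-identityʳ (adj G v u))) (allFin n)

  commonNeighbour-⊆-avoiding : ∀ {i ℓ x a} {g : Fin i → Fin n} {f : Fin ℓ → Fin n} → g ⊆ f →
                               (∀ j → g j ≢ f a) → (∀ b → b ≢ a → adj G (f b) x ≡ true) →
                               CommonNeighbour g x
  commonNeighbour-⊆-avoiding {x = x} g⊆f a∉g x~f j = let b , b≢a , gj≡fb = ⊆-avoiding g⊆f a∉g j in
    subst (λ y → adj G y x ≡ true) (sym gj≡fb) (x~f b b≢a)

  []-isClique : IsClique G 0 []
  []-isClique = (λ { {()} }) , λ ()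

  ∷-isClique : ∀ {i u} {g : Fin i → Fin n} → IsClique G i g → CommonNeighbour g u →
               IsClique G (suc i) (u ∷ g)
  ∷-isClique {u = u} {g} (g-inj , g-adj) u∈N = ∷-injective (λ j → adj⇒≢ (u∈N j)) g-inj , ∷-adj
    where
    ∷-adj : ∀ s t → s ≢ t → adj G ((u ∷ g) s) ((u ∷ g) t) ≡ true
    ∷-adj zero    zero    s≢t = contradiction refl s≢t
    ∷-adj zero    (suc j) _   = trans (adj-sym G u (g j)) (u∈N j)
    ∷-adj (suc j) zero    _   = u∈N j
    ∷-adj (suc i) (suc j) s≢t = g-adj i j (s≢t ∘ cong suc)

  ++-isClique : ∀ {i j} {f : Fin i → Fin n} {g : Fin j → Fin n} → IsClique G i f → IsClique G j g →
                (∀ a b → adj G (f a) (g b) ≡ true) → IsClique G (i + j) (f ++ g)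
  ++-isClique {i} {j} {f} {g} (f-inj , f-adj) (g-inj , g-adj) f~g =
    (λ e → splitAt-injective i (⊎-inj _ _ e)) , (λ x y x≢y → ⊎-adj _ _ (x≢y ∘ splitAt-injective i))
    where
    ⊎-inj : ∀ p q → [ f , g ]′ p ≡ [ f , g ]′ q → p ≡ q
    ⊎-inj (inj₁ a) (inj₁ b) e = cong inj₁ (f-inj e)
    ⊎-inj (inj₁ a) (inj₂ b) e = contradiction e (adj⇒≢ (f~g a b))
    ⊎-inj (inj₂ a) (inj₁ b) e = contradiction (sym e) (adj⇒≢ (f~g b a))
    ⊎-inj (inj₂ a) (inj₂ b) e = cong inj₂ (g-inj e)
    ⊎-adj : ∀ p q → p ≢ q → adj G ([ f , g ]′ p) ([ f , g ]′ q) ≡ true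
    ⊎-adj (inj₁ a) (inj₁ b) p≢q = f-adj a b (p≢q ∘ cong inj₁)
    ⊎-adj (inj₁ a) (inj₂ b) _   = f~g a b
    ⊎-adj (inj₂ a) (inj₁ b) _   = trans (adj-sym G (g a) (f b)) (f~g b a)
    ⊎-adj (inj₂ a) (inj₂ b) p≢q = g-adj a b (p≢q ∘ cong inj₂)

  updateAt-isClique : ∀ {ℓ x} {f : Fin ℓ → Fin n} → IsClique G ℓ f → ∀ a →
                      (∀ b → b ≢ a → adj G (f b) x ≡ true) → IsClique G ℓ (updateAt f a (const x))
  updateAt-isClique {ℓ} {x} {f} (f-inj , f-adj) a x~f = F-inj , F-adj
    where
    _~_ : Fin n → Fin n → Set
    u ~ v = adj G u v ≡ true
    F : Fin ℓ → Fin n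
    F = updateAt f a (const x)
    entry : ∀ b → (b ≡ a × F b ≡ x) ⊎ (b ≢ a × F b ≡ f b)
    entry b with b ≟ a
    ... | yes refl = inj₁ (refl , updateAt-updates a {const x} f)
    ... | no b≢a   = inj₂ (b≢a , updateAt-minimal b a f b≢a)
    F-inj : Injective _≡_ _≡_ F
    F-inj {b} {b′} e with entry b | entry b′
    ... | inj₁ (refl , _)   | inj₁ (refl , _)    = refl
    ... | inj₁ (_ , Fb)     | inj₂ (b′≢a , Fb′)  =
      contradiction (trans (sym Fb′) (trans (sym e) Fb)) (adj⇒≢ (x~f b′ b′≢a))
    ... | inj₂ (b≢a , Fb)   | inj₁ (_ , Fb′)     =
      contradiction (trans (sym Fb) (trans e Fb′)) (adj⇒≢ (x~f b b≢a))
    ... | inj₂ (_ , Fb)     | inj₂ (_ , Fb′)     = f-inj (trans (sym Fb) (trans e Fb′))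
    F-adj : ∀ b b′ → b ≢ b′ → adj G (F b) (F b′) ≡ true
    F-adj b b′ b≢b′ with entry b | entry b′
    ... | inj₁ (refl , _)   | inj₁ (refl , _)    = contradiction refl b≢b′
    ... | inj₁ (_ , Fb)     | inj₂ (b′≢a , Fb′)  =
      subst₂ _~_ (sym Fb) (sym Fb′) (trans (adj-sym G x (f b′)) (x~f b′ b′≢a))
    ... | inj₂ (b≢a , Fb)   | inj₁ (_ , Fb′)     = subst₂ _~_ (sym Fb) (sym Fb′) (x~f b b≢a)
    ... | inj₂ (_ , Fb)     | inj₂ (_ , Fb′)     = subst₂ _~_ (sym Fb) (sym Fb′) (f-adj b b′ b≢b′)

  clique≤colours : ∀ {m c} {P : Fin n → Set} {f : Fin m → Fin n} → IsClique G m f → (∀ a → P (f a)) →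
                   ColourableOn G P c → m ≤ c
  clique≤colours {f = f} (_ , f-adj) Pf (col , proper) = injective⇒≤ col∘f-inj
    where
    col∘f-inj : Injective _≡_ _≡_ (col ∘ f)
    col∘f-inj {a} {b} e with a ≟ b
    ... | yes a≡b = a≡b
    ... | no a≢b  = contradiction e (proper (f a) (f b) (Pf a) (Pf b) (f-adj a b a≢b))

  complete⇒Iso : ∀ {k} → Chromatic G k → (∀ u v → u ≢ v → adj G u v ≡ true) → Iso G (complete k)
  complete⇒Iso {k} χ complete-G
    with ≤-antisym (clique≤colours (id , complete-G) (λ _ → tt) (proj₁ χ))
                   (proj₂ χ n (id , λ u v _ _ uv → adj⇒≢ uv))
  ... | refl = ↔-refl , same-adj
    where
    same-adj : ∀ u v → adj G u v ≡ adj (complete n) u v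
    same-adj u v with u ≟ v
    ... | yes refl = adj-irrefl G u
    ... | no u≢v   = complete-G u v u≢v

  vertex-critical-clique⇒Iso : ∀ {k m} {f : Fin m → Fin n} → Chromatic G k →
                              (∀ v → ColourableOn G (λ u → u ≢ v) (k ∸ 1)) →
                              IsClique G m f → k ≤ m → Iso G (complete k)
  vertex-critical-clique⇒Iso {k} {m} {f} χ critical f-clique k≤m
    with all? (λ v → any? (λ a → f a ≟ v))
  ... | yes f-onto = complete⇒Iso χ (λ u v u≢v → adjacent (f-onto u) (f-onto v) u≢v)
    where
    adjacent : ∀ {u v} → ∃ (λ a → f a ≡ u) → ∃ (λ b → f b ≡ v) → u ≢ v → adj G u v ≡ true
    adjacent (a , refl) (b , refl) fa≢fb = proj₂ f-clique a b (fa≢fb ∘ cong f)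
  ... | no ¬f-onto =
    ⊥-elim (<-irrefl refl (m≤pred[n]⇒suc[m]≤n {{nonZeroIndex (proj₁ (proj₁ χ) v)}} k≤k∸1))
    where
    missed = ¬∀⟶∃¬ n _ (λ v → any? (λ a → f a ≟ v)) ¬f-onto
    v = proj₁ missed
    k≤k∸1 : k ≤ k ∸ 1
    k≤k∸1 = ≤-trans k≤m (clique≤colours f-clique (curry (proj₂ missed)) (critical v))

module Recolouring {n} (G : Graph n) {ℓ′ m} (f : Fin (suc ℓ′) → Fin n) (c : Fin n → Fin m)
  (c-proper : ∀ u v → Outside f u → Outside f v → adj G u v ≡ true → c u ≢ c v) (α : Fin m) where

  Witness : Fin n → Set
  Witness w = Outside f w × c w ≡ α × CommonNeighbour G f w

  witness? : Decidable Witness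
  witness? w = all? (λ a → ¬? (f a ≟ w)) ×-dec (c w ≟ α) ×-dec commonNeighbour? G f w

  data Class (v : Fin n) : Set where
    on-clique : ∀ b → f b ≡ v → Class v
    kept      : Outside f v → c v ≢ α → Class v
    moved     : Outside f v → c v ≡ α → ∀ b → adj G (f b) v ≡ false → Class v

  classify : ∀ v → ¬ Witness v → Class v
  classify v ¬witness with any? (λ b → f b ≟ v)
  ... | yes (b , fb≡v) = on-clique b fb≡v
  ... | no v∉f with c v ≟ α
  ...   | no cv≢α = kept (curry v∉f) cv≢α
  ...   | yes cv≡α with any? (λ b → adj G (f b) v ≟ᵇ false)
  ...     | yes (b , fb≁v) = moved (curry v∉f) cv≡α b fb≁v
  ...     | no v∈N = contradiction (curry v∉f , cv≡α , λ b → ¬-not (curry v∈N b)) ¬witness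

  clique-colour : Fin (suc ℓ′) → Fin m ⊎ Fin ℓ′
  clique-colour zero    = inj₁ α
  clique-colour (suc b) = inj₂ b

  clique-colour-injective : Injective _≡_ _≡_ clique-colour
  clique-colour-injective {zero}  {zero}  _    = refl
  clique-colour-injective {suc b} {suc b} refl = refl

  clique-colour≢kept : ∀ b {β} → β ≢ α → clique-colour b ≢ inj₁ β
  clique-colour≢kept zero β≢α refl = β≢α refl

  colour : ∀ {v} → Class v → Fin m ⊎ Fin ℓ′
  colour (on-clique b _)   = clique-colour b
  colour {v} (kept _ _)    = inj₁ (c v)
  colour (moved _ _ b _)   = clique-colour b

  colour-proper : ∀ {u v} → adj G u v ≡ true → (cu : Class u) (cv : Class v) → colour cu ≢ colour cv
  colour-proper uv (on-clique b refl) (on-clique b′ refl) e with clique-colour-injective e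
  ... | refl = adj⇒≢ G uv refl
  colour-proper uv (on-clique b _) (kept _ cv≢α) e = clique-colour≢kept b cv≢α e
  colour-proper uv (on-clique b refl) (moved _ _ b′ b′≁v) e with clique-colour-injective e
  ... | refl = case trans (sym uv) b′≁v of λ ()
  colour-proper uv (kept _ cu≢α) (on-clique b _) e = clique-colour≢kept b cu≢α (sym e)
  colour-proper uv (kept u∉f _) (kept v∉f _) e = c-proper _ _ u∉f v∉f uv (inj₁-injective e)
  colour-proper uv (kept _ cu≢α) (moved _ _ b _) e = clique-colour≢kept b cu≢α (sym e)
  colour-proper {u} {v} uv (moved _ _ b b≁u) (on-clique b′ refl) e with clique-colour-injective e
  ... | refl = case trans (sym (trans (adj-sym G v u) uv)) b≁u of λ ()
  colour-proper uv (moved _ _ b _) (kept _ cv≢α) e = clique-colour≢kept b cv≢α e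
  colour-proper uv (moved u∉f cu≡α _ _) (moved v∉f cv≡α _ _) _ =
    c-proper _ _ u∉f v∉f uv (trans cu≡α (sym cv≡α))

  colourable-or-witness : ColourableOn G (λ _ → ⊤) (m + ℓ′) ⊎ ∃ Witness
  colourable-or-witness with any? witness?
  ... | yes witness = inj₂ witness
  ... | no ¬witness =
    inj₁ (join m ℓ′ ∘ colour ∘ class ,
          λ u v _ _ uv → colour-proper uv (class u) (class v) ∘ join-injective m)
    where
    class : ∀ v → Class v
    class v = classify v (¬witness ∘ (v ,_))

module KCriticalGraph {n} {G : Graph n} {ℓ′ k} (G-critical : KCritical G (suc ℓ′) k) where

  ℓ : ℕ
  ℓ = suc ℓ′

  χ : Chromatic G k
  χ = proj₁ G-critical

  vertex-removed-colourable : ∀ v → ColourableOn G (λ u → u ≢ v) (k ∸ 1)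
  vertex-removed-colourable v = proj₁ (proj₁ (proj₂ (proj₂ G-critical)) v)

  clique-removed-colourable : ∀ f → IsClique G ℓ f → ColourableOn G (Outside f) (k ∸ ℓ)
  clique-removed-colourable f f-clique = proj₁ (proj₂ (proj₂ (proj₂ G-critical)) f f-clique)

  ℓ≤k : ℓ ≤ k
  ℓ≤k = clique≤colours G (proj₂ (proj₁ (proj₂ G-critical))) (λ _ → tt) (proj₁ χ)

  commonNeighbour-in-every-colour :
    (f : Fin ℓ → Fin n) (c : Fin n → Fin (k ∸ ℓ)) →
    (∀ u v → Outside f u → Outside f v → adj G u v ≡ true → c u ≢ c v) →
    ∀ α → ∃ λ w → Outside f w × c w ≡ α × CommonNeighbour G f w
  commonNeighbour-in-every-colour f c c-proper α
    with Recolouring.colourable-or-witness G f c c-proper α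
  ... | inj₂ witness = witness
  ... | inj₁ colouring = contradiction (proj₂ χ _ colouring) (<⇒≱ fewer-colours)
    where
    fewer-colours : k ∸ ℓ + ℓ′ < k
    fewer-colours = ≤-reflexive (trans (sym (+-suc (k ∸ ℓ) ℓ′)) (m∸n+n≡m ℓ≤k))

  commonNeighbour-family : ∀ f → IsClique G ℓ f →
    ∃ λ (r : Fin (k ∸ ℓ) → Fin n) → Injective _≡_ _≡_ r × ∀ α → CommonNeighbour G f (r α)
  commonNeighbour-family f f-clique = r , r-inj , r∈N
    where
    c : Fin n → Fin (k ∸ ℓ)
    c = proj₁ (clique-removed-colourable f f-clique)
    meets = commonNeighbour-in-every-colour f c (proj₂ (clique-removed-colourable f f-clique))
    r : Fin (k ∸ ℓ) → Fin n
    r α = proj₁ (meets α)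
    c∘r≡id : ∀ α → c (r α) ≡ α
    c∘r≡id α = let _ , _ , cw≡α , _ = meets α in cw≡α
    r∈N : ∀ α → CommonNeighbour G f (r α)
    r∈N α = let _ , _ , _ , w∈N = meets α in w∈N
    r-inj : Injective _≡_ _≡_ r
    r-inj {α} {β} e = trans (sym (c∘r≡id α)) (trans (cong c e) (c∘r≡id β))

  k∸ℓ≤commonDeg : ∀ {f} → IsClique G ℓ f → k ∸ ℓ ≤ commonDeg G f
  k∸ℓ≤commonDeg {f} f-clique =
    let r , r-inj , r∈N = commonNeighbour-family f f-clique in commonDeg-≥ G r-inj r∈N

  exchange-vertex : ∀ {f} → IsClique G ℓ f → ∀ a {u z} → CommonNeighbour G f u → CommonNeighbour G f z →
                    u ≢ z → adj G u z ≡ false →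
                    ∃ λ w → w ≢ u × w ≢ z × adj G u w ≡ false × (∀ b → b ≢ a → adj G (f b) w ≡ true)
  exchange-vertex {f} f-clique a {u} {z} u∈N z∈N u≢z u≁z = w , w≢u , w≢z , u≁w , w~f
    where
    F : Fin ℓ → Fin n
    F = updateAt f a (const z)
    Fa≡z : F a ≡ z
    Fa≡z = updateAt-updates a {const z} f
    Fb≡fb : ∀ b → b ≢ a → F b ≡ f b
    Fb≡fb b b≢a = updateAt-minimal b a f b≢a
    F-colouring = clique-removed-colourable F (updateAt-isClique G f-clique a (λ b _ → z∈N b))
    c = proj₁ F-colouring
    meets = commonNeighbour-in-every-colour F c (proj₂ F-colouring) (c u)
    w = proj₁ meets
    w∉F : Outside F w
    w∉F = proj₁ (proj₂ meets)
    cw≡cu : c w ≡ c u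
    cw≡cu = proj₁ (proj₂ (proj₂ meets))
    w∈N : CommonNeighbour G F w
    w∈N = proj₂ (proj₂ (proj₂ meets))
    u∉F : Outside F u
    u∉F b Fb≡u with b ≟ a
    ... | yes refl = u≢z (trans (sym Fb≡u) Fa≡z)
    ... | no b≢a   = adj⇒≢ G (u∈N b) (trans (sym (Fb≡fb b b≢a)) Fb≡u)
    w≢z : w ≢ z
    w≢z w≡z = w∉F a (trans Fa≡z (sym w≡z))
    w≢u : w ≢ u
    w≢u w≡u = case trans (sym u≁z) (trans (adj-sym G u z) z~u) of λ ()
      where
      z~u : adj G z u ≡ true
      z~u = subst₂ (λ x y → adj G x y ≡ true) Fa≡z w≡u (w∈N a)
    u≁w : adj G u w ≡ false
    u≁w = ¬-not (λ u~w → proj₂ F-colouring u w u∉F w∉F u~w (sym cw≡cu))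
    w~f : ∀ b → b ≢ a → adj G (f b) w ≡ true
    w~f b b≢a = subst (λ x → adj G x w ≡ true) (Fb≡fb b b≢a) (w∈N b)

  module _ (not-complete : ¬ Iso G (complete k)) where

    nonadjacent-commonNeighbours : ∀ {f} → IsClique G ℓ f →
      ∃₂ λ u z → CommonNeighbour G f u × CommonNeighbour G f z × u ≢ z × adj G u z ≡ false
    nonadjacent-commonNeighbours {f} f-clique
      with commonNeighbour-family f f-clique
         | any? (λ u → any? (λ z → commonNeighbour? G f u ×-dec commonNeighbour? G f z ×-dec
                                   ¬? (u ≟ z) ×-dec (adj G u z ≟ᵇ false)))
    ... | _ | yes (u , z , pair) = u , z , pair
    ... | r , r-inj , r∈N | no none =
      contradiction (vertex-critical-clique⇒Iso G χ vertex-removed-colourable f++r-clique (m≤n+m∸n k ℓ))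
                    not-complete
      where
      N-clique : ∀ {u z} → CommonNeighbour G f u → CommonNeighbour G f z → u ≢ z → adj G u z ≡ true
      N-clique u∈N z∈N u≢z = ¬-not (λ u≁z → none (_ , _ , u∈N , z∈N , u≢z , u≁z))
      r-clique : IsClique G (k ∸ ℓ) r
      r-clique = r-inj , λ α β α≢β → N-clique (r∈N α) (r∈N β) (α≢β ∘ r-inj)
      f++r-clique : IsClique G (ℓ + (k ∸ ℓ)) (f ++ r)
      f++r-clique = ++-isClique G f-clique r-clique (λ a α → r∈N α a)

    extend-clique : ∀ {i} {g : Fin i → Fin n} → i < ℓ → IsClique G i g →
                    ∀ {f} → IsClique G ℓ f → g ⊆ f →
                    ∃ λ u → IsClique G (suc i) (u ∷ g) × (∃ λ f′ → IsClique G ℓ f′ × (u ∷ g) ⊆ f′)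
                          × commonDeg G (u ∷ g) + 3 ≤ commonDeg G g
    extend-clique {i} {g} i<ℓ g-clique {f} f-clique g⊆f
      with missed-vertex {g = g} i<ℓ (proj₁ f-clique) | nonadjacent-commonNeighbours f-clique
    ... | a , a∉g | u , z , u∈N , z∈N , u≢z , u≁z
      with exchange-vertex f-clique a u∈N z∈N u≢z u≁z
    ... | w , w≢u , w≢z , u≁w , w~f =
      u , ∷-isClique G g-clique (N-g (λ b _ → u∈N b)) ,
      (updateAt f a (const u) , updateAt-isClique G f-clique a (λ b _ → u∈N b) , ∷-⊆-updateAt g⊆f a∉g) ,
      commonDeg-∷ G triple-inj triple∈N u≁triple
      where
      N-g : ∀ {x} → (∀ b → b ≢ a → adj G (f b) x ≡ true) → CommonNeighbour G g x
      N-g = commonNeighbour-⊆-avoiding G g⊆f a∉g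
      triple : Fin 3 → Fin n
      triple = u ∷ z ∷ w ∷ []
      triple-inj : Injective _≡_ _≡_ triple
      triple-inj = ∷-injective (λ { zero → u≢z ∘ sym ; (suc zero) → w≢u ; (suc (suc ())) })
                     (∷-injective (λ { zero → w≢z ; (suc ()) }) (∷-injective (λ ()) (λ { {()} })))
      triple∈N : ∀ t → CommonNeighbour G g (triple t)
      triple∈N zero             = N-g (λ b _ → u∈N b)
      triple∈N (suc zero)       = N-g (λ b _ → z∈N b)
      triple∈N (suc (suc zero)) = N-g w~f
      u≁triple : ∀ t → adj G u (triple t) ≡ false
      u≁triple zero             = adj-irrefl G u
      u≁triple (suc zero)       = u≁z
      u≁triple (suc (suc zero)) = u≁w

    commonDeg-bound : ∀ r {i} {g : Fin i → Fin n} → i + r ≡ ℓ → IsClique G i g →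
                      (∃ λ f → IsClique G ℓ f × g ⊆ f) → k ∸ ℓ + 3 * r ≤ commonDeg G g
    commonDeg-bound zero {i} i+0≡ℓ g-clique _ with trans (sym (+-identityʳ i)) i+0≡ℓ
    ... | refl = ≤-trans (≤-reflexive (+-identityʳ (k ∸ ℓ))) (k∸ℓ≤commonDeg g-clique)
    commonDeg-bound (suc r) {i} {g} i+r+1≡ℓ g-clique (f , f-clique , g⊆f) =
      let u , u∷g-clique , u∷g⊆K , fewer =
            extend-clique (<-≤-trans (m<m+n i z<s) (≤-reflexive i+r+1≡ℓ)) g-clique f-clique g⊆f
      in begin
      k ∸ ℓ + 3 * suc r        ≡⟨ cong (k ∸ ℓ +_) (trans (*-suc 3 r) (+-comm 3 (3 * r))) ⟩
      k ∸ ℓ + (3 * r + 3)      ≡⟨ +-assoc (k ∸ ℓ) (3 * r) 3 ⟨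
      k ∸ ℓ + 3 * r + 3        ≤⟨ +-monoˡ-≤ 3 (commonDeg-bound r i+1+r≡ℓ u∷g-clique u∷g⊆K) ⟩
      commonDeg G (u ∷ g) + 3  ≤⟨ fewer ⟩
      commonDeg G g            ∎
      where
      open ≤-Reasoning
      i+1+r≡ℓ : suc i + r ≡ ℓ
      i+1+r≡ℓ = trans (sym (+-suc i r)) i+r+1≡ℓ

    degree-bound : ∀ {v} → (∃ λ f → IsClique G ℓ f × ∃ λ a → f a ≡ v) → k ∸ ℓ + 3 * ℓ′ ≤ degree G v
    degree-bound {v} (f , f-clique , a , fa≡v) =
      subst (k ∸ ℓ + 3 * ℓ′ ≤_) (sym (degree≡commonDeg G v))
        (commonDeg-bound ℓ′ refl (∷-isClique G ([]-isClique G) (λ ()))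
                         (f , f-clique , λ { zero → a , sym fa≡v ; (suc ()) }))

degree-arithmetic : ∀ {k ℓ′} → suc ℓ′ ≤ k → k + 2 * suc ℓ′ ∸ 3 ≡ k ∸ suc ℓ′ + 3 * ℓ′
degree-arithmetic {k} {ℓ′} ℓ≤k = begin
  k + 2 * suc ℓ′ ∸ 3                    ≡⟨ cong (λ x → x + 2 * suc ℓ′ ∸ 3) (m∸n+n≡m ℓ≤k) ⟨
  k ∸ suc ℓ′ + suc ℓ′ + 2 * suc ℓ′ ∸ 3  ≡⟨ cong (_∸ 3) (regroup (k ∸ suc ℓ′) ℓ′) ⟩
  3 + (k ∸ suc ℓ′ + 3 * ℓ′) ∸ 3         ≡⟨ m+n∸m≡n 3 _ ⟩
  k ∸ suc ℓ′ + 3 * ℓ′                   ∎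
  where
  open ≡-Reasoning
  regroup : ∀ d ℓ′ → d + suc ℓ′ + 2 * suc ℓ′ ≡ 3 + (d + 3 * ℓ′)
  regroup = solve-∀

lemma8 : ∀ {n} (G : Graph n) (ℓ k : ℕ) → 2 ≤ ℓ → KCritical G ℓ k →
    ¬ Iso G (complete k) →
    (∀ (v : Fin n) → (∃[ f ] (IsClique G ℓ f × ∃[ a ] f a ≡ v)) →
       k + 2 * ℓ ∸ 3 ≤ degree G v)
    × (∀ (i : ℕ) → 1 ≤ i → i ≤ ℓ → (g : Fin i → Fin n) → IsClique G i g →
       (∃[ f ] (IsClique G ℓ f × (∀ j → ∃[ a ] g j ≡ f a))) →
       (k ∸ ℓ) + 3 * (ℓ ∸ i) ≤ commonDeg G g)
lemma8 G (suc ℓ′) k (s≤s _) G-critical not-complete =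
  (λ v on-K → subst (_≤ degree G v) (sym (degree-arithmetic ℓ≤k)) (degree-bound not-complete on-K)) ,
  (λ i _ i≤ℓ g g-clique g⊆K → commonDeg-bound not-complete (suc ℓ′ ∸ i) (m+[n∸m]≡n i≤ℓ) g-clique g⊆K)
  where
  open KCriticalGraph {G = G} {ℓ′} {k} G-critical
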